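{- Independence complexes of matroids are shelling completable: if $\mathcal{M}$ is a matroid of rank $d$ on ground set $V$ with $|V|=n$, then there is a shelling of $\mathcal{M}$ which is the initial segment of a shelling of the complex whose facets are all $d$-subsets of $V$.
   Context: A matroid of rank $d$ is a pure simplicial complex on $V$ whose facets (bases) all have $d$ elements and satisfy: for facets $F,G$ and $x\in F\setminus G$ there is $y\in G\setminus F$ with $(F\setminus\{x\})\cup\{y\}$ a facet. A pure $(d-1)$-dimensional complex is shellable if its facets can be ordered $F_1,\dots,F_s$ (a shelling) so that for each $k\ge 2$ the complex generated by the sets $F_i\cap F_k$, $i<k$, is pure of dimension $d-2$. Shelling completable means there is a shelling of the complex that is an initial segment of a shelling of the full $(d-1)$-skeleton of the simplex on $V$. -}

module Defs where

open import Data.Nat using (ℕ; _∸_)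
open import Data.Fin using (Fin)
open import Data.Fin.Subset as S using (Subset; _∩_; _∪_; _-_; _⊆_; ∣_∣; ⁅_⁆)
open import Data.List using (List; _++_; _∷_)
open import Data.List.Membership.Propositional using (_∈_)
open import Data.List.Relation.Unary.Unique.Propositional using (Unique)
open import Data.Product using (Σ; ∃; _×_)
open import Relation.Nullary using (Dec)
open import Relation.Unary using (Decidable)
open import Relation.Binary.PropositionalEquality using (_≡_)
open import Function.Bundles using (_⇔_)

-- A matroid of rank d on ground set V = Fin n, given by its set of bases
-- (the facets of its independence complex).
record Matroid (n d : ℕ) : Set₁ where
  field
    IsBasis   : Subset n → Set
    isBasis?  : Decidable IsBasis
    nonempty  : ∃ λ F → IsBasis F
    basisSize : ∀ F → IsBasis F → ∣ F ∣ ≡ d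
    exchange  : ∀ F G x → IsBasis F → IsBasis G → x S.∈ F → x S.∉ G →
                ∃ λ y → y S.∈ G × y S.∉ F × IsBasis ((F - x) ∪ ⁅ y ⁆)

-- For a facet F_k preceded by the facets `before` = F_1,…,F_{k-1}:
-- the complex generated by the sets F_i ∩ F_k (i < k) is pure of
-- dimension d-2, i.e. every generator lies in a generator with d-1 elements
-- (so every facet of the generated complex has exactly d-1 elements).
PureStep : ∀ {n} → ℕ → List (Subset n) → Subset n → Set
PureStep d before F =
  ∀ G → G ∈ before →
  ∃ λ H → H ∈ before × (G ∩ F) ⊆ (H ∩ F) × ∣ H ∩ F ∣ ≡ d ∸ 1

ShellingOrder : ∀ {n} → ℕ → List (Subset n) → Set
ShellingOrder {n} d L =
  ∀ (xs ys : List (Subset n)) (F : Subset n) → L ≡ xs ++ (F ∷ ys) → PureStep d xs F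

IsShellingOf : ∀ {n} → ℕ → (Subset n → Set) → List (Subset n) → Set
IsShellingOf d Facet L =
  Unique L × (∀ F → (F ∈ L) ⇔ Facet F) × ShellingOrder d L

DSubset : ∀ {n} → ℕ → Subset n → Set
DSubset d F = ∣ F ∣ ≡ d

ShellingCompletable : ∀ {n} → ℕ → (Subset n → Set) → Set
ShellingCompletable {n} d Facet =
  ∃ λ (L : List (Subset n)) → ∃ λ (L′ : List (Subset n)) →
    IsShellingOf d Facet L × IsShellingOf d (DSubset d) (L ++ L′)

-- Order the d-subsets by decreasing matroid rank, ties broken lexicographically; the
-- bases, being exactly the d-subsets of rank d, come first.  This order is a shelling:
-- if G precedes F, then either rank G > rank F and some x ∈ F ─ G can be exchanged for
-- a y ∉ F raising the rank, or rank G = rank F, G <lex F, and the first element x at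
-- which they differ can be exchanged for some y ∈ G ─ F without lowering the rank.
-- Either way F - x + y precedes F, meets F in d - 1 elements and contains G ∩ F.

module Submission where

open import Defs
open import Data.Bool as Bool using (f<t)
import Data.Bool.Properties as Boolₚ
open import Data.Empty using (⊥-elim)
open import Data.Fin using (Fin; zero; suc)
open import Data.Fin.Properties using (any?)
open import Data.Fin.Subset
  using (Subset; inside; outside; _∈_; _∉_; _⊆_; _∩_; _∪_; _─_; _-_; ⁅_⁆; ∣_∣)
open import Data.Fin.Subset.Properties
open import Data.List using (List; []; _∷_; [_]; _++_; map; filter)
open import Data.List.Extrema.Nat using (argmax; argmax-all; f[xs]≤f[argmax])
open import Data.List.Membership.Propositional using () renaming (_∈_ to _∈ₗ_)
open import Data.List.Membership.Propositional.Properties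
  using (∈-++⁺ˡ; ∈-++⁺ʳ; ∈-++⁻; ∈-map⁺; ∈-filter⁺; ∈-filter⁻)
open import Data.List.Properties using (++-assoc)
import Data.List.Relation.Unary.All as All
import Data.List.Relation.Unary.All.Properties as Allₚ
open import Data.List.Relation.Unary.AllPairs as AllPairs using (AllPairs; []; _∷_)
import Data.List.Relation.Unary.AllPairs.Properties as AllPairsₚ
import Data.List.Relation.Unary.Any as Any
open import Data.List.Relation.Unary.Unique.Propositional using (Unique)
open import Data.Nat using (ℕ; zero; suc; _+_; _∸_; _≤_; _<_; _>_; _≤?_; _≟_; s≤s)
open import Data.Nat.Induction using (<-wellFounded)
open import Data.Nat.Properties
open import Data.Product using (∃; ∃₂; _×_; _,_; proj₁; proj₂)
open import Data.Product.Relation.Binary.Lex.Strict using (×-Lex; ×-asymmetric)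
open import Data.Sum using (_⊎_; inj₁; inj₂; map₂)
open import Data.Vec using ([]; _∷_; here; there)
open import Data.Vec.Relation.Binary.Lex.Strict using (Lex-<; this; next)
import Data.Vec.Relation.Binary.Lex.Strict as Lex
open import Function using (_∘_; _on_)
open import Function.Bundles using (_⇔_; mk⇔; Equivalence)
open import Induction.WellFounded using (Acc; acc)
open import Level using (Level)
open import Relation.Binary using (Rel; Asymmetric)
open import Relation.Binary.PropositionalEquality hiding ([_])
open import Relation.Nullary using (Dec; yes; no; ¬?; _×-dec_)

private
  variable
    a ℓ : Level
    A : Set a
    n : ℕ

∣p∣≡∣p∩q∣+∣p─q∣ : (p q : Subset n) → ∣ p ∣ ≡ ∣ p ∩ q ∣ + ∣ p ─ q ∣
∣p∣≡∣p∩q∣+∣p─q∣ []            []            = refl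
∣p∣≡∣p∩q∣+∣p─q∣ (inside ∷ p)  (inside ∷ q)  = cong suc (∣p∣≡∣p∩q∣+∣p─q∣ p q)
∣p∣≡∣p∩q∣+∣p─q∣ (inside ∷ p)  (outside ∷ q) =
  trans (cong suc (∣p∣≡∣p∩q∣+∣p─q∣ p q)) (sym (+-suc _ _))
∣p∣≡∣p∩q∣+∣p─q∣ (outside ∷ p) (inside ∷ q)  = ∣p∣≡∣p∩q∣+∣p─q∣ p q
∣p∣≡∣p∩q∣+∣p─q∣ (outside ∷ p) (outside ∷ q) = ∣p∣≡∣p∩q∣+∣p─q∣ p q

∣p∣≡∣q∣⇒∣p─q∣≡∣q─p∣ : (p q : Subset n) → ∣ p ∣ ≡ ∣ q ∣ → ∣ p ─ q ∣ ≡ ∣ q ─ p ∣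
∣p∣≡∣q∣⇒∣p─q∣≡∣q─p∣ p q ∣p∣≡∣q∣ = +-cancelˡ-≡ ∣ p ∩ q ∣ _ _ (begin
  ∣ p ∩ q ∣ + ∣ p ─ q ∣ ≡⟨ sym (∣p∣≡∣p∩q∣+∣p─q∣ p q) ⟩
  ∣ p ∣                 ≡⟨ ∣p∣≡∣q∣ ⟩
  ∣ q ∣                 ≡⟨ ∣p∣≡∣p∩q∣+∣p─q∣ q p ⟩
  ∣ q ∩ p ∣ + ∣ q ─ p ∣ ≡⟨ cong (λ r → ∣ r ∣ + ∣ q ─ p ∣) (∩-comm q p) ⟩
  ∣ p ∩ q ∣ + ∣ q ─ p ∣ ∎)
  where open ≡-Reasoning

x∈p─q⇒x∉q : ∀ {x : Fin n} (p q : Subset n) → x ∈ p ─ q → x ∉ q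
x∈p─q⇒x∉q (_ ∷ p) (inside ∷ q) () here
x∈p─q⇒x∉q (_ ∷ p) (_ ∷ q) (there x∈p─q) (there x∈q) = x∈p─q⇒x∉q p q x∈p─q x∈q

x∈p-y⇒x≢y : ∀ {x y : Fin n} (p : Subset n) → x ∈ p - y → x ≢ y
x∈p-y⇒x≢y {x = x} p x∈p-x refl = x∈p─q⇒x∉q p ⁅ x ⁆ x∈p-x (x∈⁅x⁆ x)

x∉p-y∧x≢y⇒x∉p : ∀ {x y : Fin n} {p : Subset n} → x ∉ p - y → x ≢ y → x ∉ p
x∉p-y∧x≢y⇒x∉p x∉p-y x≢y x∈p = x∉p-y (x∈p∧x≢y⇒x∈p-y x∈p x≢y)

x∉p⇒∣p∪⁅x⁆∣≡1+∣p∣ : ∀ {x : Fin n} (p : Subset n) → x ∉ p → ∣ p ∪ ⁅ x ⁆ ∣ ≡ suc ∣ p ∣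
x∉p⇒∣p∪⁅x⁆∣≡1+∣p∣ {x = zero}  (inside ∷ p)  x∉p = ⊥-elim (x∉p here)
x∉p⇒∣p∪⁅x⁆∣≡1+∣p∣ {x = zero}  (outside ∷ p) _   = cong (suc ∘ ∣_∣) (∪-identityʳ p)
x∉p⇒∣p∪⁅x⁆∣≡1+∣p∣ {x = suc x} (inside ∷ p)  x∉p = cong suc (x∉p⇒∣p∪⁅x⁆∣≡1+∣p∣ p (x∉p ∘ there))
x∉p⇒∣p∪⁅x⁆∣≡1+∣p∣ {x = suc x} (outside ∷ p) x∉p = x∉p⇒∣p∪⁅x⁆∣≡1+∣p∣ p (x∉p ∘ there)

x∈p⇒1+∣p-x∣≡∣p∣ : ∀ {x : Fin n} (p : Subset n) → x ∈ p → suc ∣ p - x ∣ ≡ ∣ p ∣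
x∈p⇒1+∣p-x∣≡∣p∣ {x = zero}  (inside ∷ p)  here        = cong (suc ∘ ∣_∣) (p─⊥≡p p)
x∈p⇒1+∣p-x∣≡∣p∣ {x = suc x} (inside ∷ p)  (there x∈p) = cong suc (x∈p⇒1+∣p-x∣≡∣p∣ p x∈p)
x∈p⇒1+∣p-x∣≡∣p∣ {x = suc x} (outside ∷ p) (there x∈p) = x∈p⇒1+∣p-x∣≡∣p∣ p x∈p

∣p∣≤1+∣p-x∣ : (p : Subset n) (x : Fin n) → ∣ p ∣ ≤ suc ∣ p - x ∣
∣p∣≤1+∣p-x∣ p x = begin
  ∣ p ∣                     ≡⟨ ∣p∣≡∣p∩q∣+∣p─q∣ p ⁅ x ⁆ ⟩
  ∣ p ∩ ⁅ x ⁆ ∣ + ∣ p - x ∣ ≤⟨ +-monoˡ-≤ ∣ p - x ∣ (∣p∩q∣≤∣q∣ p ⁅ x ⁆) ⟩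
  ∣ ⁅ x ⁆ ∣ + ∣ p - x ∣     ≡⟨ cong (_+ ∣ p - x ∣) (∣⁅x⁆∣≡1 x) ⟩
  suc ∣ p - x ∣             ∎
  where open ≤-Reasoning

∣q∣<∣p∣⇒∃x∈p∧x∉q : (p q : Subset n) → ∣ q ∣ < ∣ p ∣ → ∃ λ x → x ∈ p × x ∉ q
∣q∣<∣p∣⇒∃x∈p∧x∉q (inside ∷ p)  (outside ∷ q) _        = zero , here , λ ()
∣q∣<∣p∣⇒∃x∈p∧x∉q (inside ∷ p)  (inside ∷ q)  (s≤s lt) = lift (∣q∣<∣p∣⇒∃x∈p∧x∉q p q lt)
  where
  lift : ∃ (λ x → x ∈ p × x ∉ q) → ∃ λ x → x ∈ inside ∷ p × x ∉ inside ∷ q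
  lift (x , x∈p , x∉q) = suc x , there x∈p , λ { (there x∈q) → x∉q x∈q }
∣q∣<∣p∣⇒∃x∈p∧x∉q (outside ∷ p) (s ∷ q)       lt       =
  lift (∣q∣<∣p∣⇒∃x∈p∧x∉q p q (≤-<-trans (∣p∣≤∣x∷p∣ s q) lt))
  where
  lift : ∃ (λ x → x ∈ p × x ∉ q) → ∃ λ x → x ∈ outside ∷ p × x ∉ s ∷ q
  lift (x , x∈p , x∉q) = suc x , there x∈p , λ { (there x∈q) → x∉q x∈q }

p⊆q∧∣q∣≤∣p∣⇒p≡q : {p q : Subset n} → p ⊆ q → ∣ q ∣ ≤ ∣ p ∣ → p ≡ q
p⊆q∧∣q∣≤∣p∣⇒p≡q {p = p} {q} p⊆q ∣q∣≤∣p∣ = ⊆-antisym p⊆q q⊆p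
  where
  q⊆p : q ⊆ p
  q⊆p {x} x∈q with x ∈? p
  ... | yes x∈p = x∈p
  ... | no  x∉p = ⊥-elim (<⇒≱ (p⊂q⇒∣p∣<∣q∣ (p⊆q , x , x∈q , x∉p)) ∣q∣≤∣p∣)

p⊆r∧x∈r⇒p∪⁅x⁆⊆r : ∀ {p r : Subset n} {x} → p ⊆ r → x ∈ r → p ∪ ⁅ x ⁆ ⊆ r
p⊆r∧x∈r⇒p∪⁅x⁆⊆r {p = p} {x = x} p⊆r x∈r z∈ with x∈p∪q⁻ p ⁅ x ⁆ z∈
... | inj₁ z∈p   = p⊆r z∈p
... | inj₂ z∈⁅x⁆ = subst (_∈ _) (sym (x∈⁅y⁆⇒x≡y x z∈⁅x⁆)) x∈r

∣p∣≡∣q∣∧p─q⊆r⇒∣q∩r∣≤∣p∩r∣ : (p q r : Subset n) → ∣ p ∣ ≡ ∣ q ∣ → p ─ q ⊆ r →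
                            ∣ q ∩ r ∣ ≤ ∣ p ∩ r ∣
∣p∣≡∣q∣∧p─q⊆r⇒∣q∩r∣≤∣p∩r∣ p q r ∣p∣≡∣q∣ p─q⊆r = begin
  ∣ q ∩ r ∣                           ≡⟨ ∣p∣≡∣p∩q∣+∣p─q∣ (q ∩ r) p ⟩
  ∣ (q ∩ r) ∩ p ∣ + ∣ (q ∩ r) ─ p ∣   ≤⟨ +-mono-≤ (p⊆q⇒∣p∣≤∣q∣ common) (p⊆q⇒∣p∣≤∣q∣ only-q) ⟩
  ∣ (p ∩ r) ∩ q ∣ + ∣ q ─ p ∣         ≡⟨ cong (∣ (p ∩ r) ∩ q ∣ +_) (∣p∣≡∣q∣⇒∣p─q∣≡∣q─p∣ q p (sym ∣p∣≡∣q∣)) ⟩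
  ∣ (p ∩ r) ∩ q ∣ + ∣ p ─ q ∣         ≤⟨ +-monoʳ-≤ ∣ (p ∩ r) ∩ q ∣ (p⊆q⇒∣p∣≤∣q∣ only-p) ⟩
  ∣ (p ∩ r) ∩ q ∣ + ∣ (p ∩ r) ─ q ∣   ≡⟨ sym (∣p∣≡∣p∩q∣+∣p─q∣ (p ∩ r) q) ⟩
  ∣ p ∩ r ∣                           ∎
  where
  open ≤-Reasoning
  common : (q ∩ r) ∩ p ⊆ (p ∩ r) ∩ q
  common z∈ with x∈p∩q⁻ (q ∩ r) p z∈
  ... | z∈q∩r , z∈p = x∈p∩q⁺ (x∈p∩q⁺ (z∈p , p∩q⊆q q r z∈q∩r) , p∩q⊆p q r z∈q∩r)
  only-q : (q ∩ r) ─ p ⊆ q ─ p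
  only-q z∈ = x∈p∧x∉q⇒x∈p─q (p∩q⊆p q r (p─q⊆p (q ∩ r) p z∈)) (x∈p─q⇒x∉q (q ∩ r) p z∈)
  only-p : p ─ q ⊆ (p ∩ r) ─ q
  only-p z∈ = x∈p∧x∉q⇒x∈p─q (x∈p∩q⁺ (p─q⊆p p q z∈ , p─q⊆r z∈)) (x∈p─q⇒x∉q p q z∈)

replace : Subset n → Fin n → Fin n → Subset n
replace F x y = (F - x) ∪ ⁅ y ⁆

p-x⊆replace : ∀ (F : Subset n) {x} y → F - x ⊆ replace F x y
p-x⊆replace F y = p⊆p∪q ⁅ y ⁆

∈-replace⁺ : ∀ {F : Subset n} {x z} y → z ∈ F → z ≢ x → z ∈ replace F x y
∈-replace⁺ {F = F} y z∈F z≢x = p-x⊆replace F y (x∈p∧x≢y⇒x∈p-y z∈F z≢x)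

y∈replace : ∀ (F : Subset n) x y → y ∈ replace F x y
y∈replace F x y = q⊆p∪q (F - x) ⁅ y ⁆ (x∈⁅x⁆ y)

∈-replace⁻ : ∀ (F : Subset n) {x y z} → z ∈ replace F x y → z ∈ F - x ⊎ z ≡ y
∈-replace⁻ F {x} {y} z∈ = map₂ (x∈⁅y⁆⇒x≡y y) (x∈p∪q⁻ (F - x) ⁅ y ⁆ z∈)

∣replace∣≡∣p∣ : ∀ {F : Subset n} {x y} → x ∈ F → y ∉ F → ∣ replace F x y ∣ ≡ ∣ F ∣
∣replace∣≡∣p∣ {F = F} {x} x∈F y∉F =
  trans (x∉p⇒∣p∪⁅x⁆∣≡1+∣p∣ (F - x) (y∉F ∘ p─q⊆p F ⁅ x ⁆)) (x∈p⇒1+∣p-x∣≡∣p∣ F x∈F)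

replace∩p≡p-x : ∀ {F : Subset n} {x y} → y ∉ F → replace F x y ∩ F ≡ F - x
replace∩p≡p-x {F = F} {x} {y} y∉F =
  ⊆-antisym ⊆-p-x (λ z∈F-x → x∈p∩q⁺ (p-x⊆replace F y z∈F-x , p─q⊆p F ⁅ x ⁆ z∈F-x))
  where
  ⊆-p-x : replace F x y ∩ F ⊆ F - x
  ⊆-p-x z∈ with x∈p∩q⁻ (replace F x y) F z∈
  ... | z∈H , z∈F with ∈-replace⁻ F z∈H
  ... | inj₁ z∈F-x = z∈F-x
  ... | inj₂ refl  = ⊥-elim (y∉F z∈F)

∣replace─q∣<∣p─q∣ : ∀ {p q : Subset n} {x y} → x ∈ p → x ∉ q → y ∈ q →
                     ∣ replace p x y ─ q ∣ < ∣ p ─ q ∣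
∣replace─q∣<∣p─q∣ {p = p} {q} {x} {y} x∈p x∉q y∈q =
  p⊂q⇒∣p∣<∣q∣ (p′─q⊆p─q , x , x∈p∧x∉q⇒x∈p─q x∈p x∉q , x∉p′─q)
  where
  p′─q⊆p─q : replace p x y ─ q ⊆ p ─ q
  p′─q⊆p─q z∈ with ∈-replace⁻ p (p─q⊆p _ q z∈)
  ... | inj₁ z∈p-x = x∈p∧x∉q⇒x∈p─q (p─q⊆p p ⁅ x ⁆ z∈p-x) (x∈p─q⇒x∉q _ q z∈)
  ... | inj₂ refl  = ⊥-elim (x∈p─q⇒x∉q _ q z∈ y∈q)
  x∉p′─q : x ∉ replace p x y ─ q
  x∉p′─q x∈ with ∈-replace⁻ p (p─q⊆p _ q x∈)
  ... | inj₁ x∈p-x = x∈p-y⇒x≢y p x∈p-x refl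
  ... | inj₂ refl  = x∉q y∈q

_<ₗₑₓ_ : Subset n → Subset n → Set
_<ₗₑₓ_ = Lex-< _≡_ Bool._<_

<ₗₑₓ-asym : Asymmetric (_<ₗₑₓ_ {n})
<ₗₑₓ-asym = Lex.<-asym sym Boolₚ.<-resp₂-≡ Boolₚ.<-asym

-- The first position where F and G differ is the x to remove; any y of G outside F lies after it.
<ₗₑₓ-replace : {G F : Subset n} → G <ₗₑₓ F →
  ∃ λ x → x ∈ F × x ∉ G × (∀ {y} → y ∈ G → y ∉ F → replace F x y <ₗₑₓ F)
<ₗₑₓ-replace (this f<t refl) = zero , here , (λ ()) , λ { {suc y} _ _ → this f<t refl }
<ₗₑₓ-replace {G = b ∷ G} {b ∷ F} (next refl G<F) with <ₗₑₓ-replace G<F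
... | x , x∈F , x∉G , lower = suc x , there x∈F , (λ { (there x∈G) → x∉G x∈G }) , lower′
  where
  lower′ : ∀ {y} → y ∈ b ∷ G → y ∉ b ∷ F → replace (b ∷ F) (suc x) y <ₗₑₓ (b ∷ F)
  lower′ {zero}  here        y∉F = ⊥-elim (y∉F here)
  lower′ {suc y} (there y∈G) y∉F = next (Boolₚ.∨-identityʳ b) (lower y∈G (y∉F ∘ there))

subsets : ∀ n → List (Subset n)
subsets zero    = [ [] ]
subsets (suc n) = map (outside ∷_) (subsets n) ++ map (inside ∷_) (subsets n)

∈-subsets : ∀ (p : Subset n) → p ∈ₗ subsets n
∈-subsets []                    = Any.here refl
∈-subsets {suc n} (outside ∷ p) = ∈-++⁺ˡ (∈-map⁺ (outside ∷_) (∈-subsets p))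
∈-subsets {suc n} (inside ∷ p)  =
  ∈-++⁺ʳ (map (outside ∷_) (subsets n)) (∈-map⁺ (inside ∷_) (∈-subsets p))

subsets-sorted : ∀ n → AllPairs _<ₗₑₓ_ (subsets n)
subsets-sorted zero    = All.[] ∷ []
subsets-sorted (suc n) = AllPairsₚ.++⁺ sorted-∷ sorted-∷
  (Allₚ.map⁺ (All.tabulate λ _ → Allₚ.map⁺ (All.tabulate λ _ → this f<t refl)))
  where
  sorted-∷ : ∀ {b} → AllPairs _<ₗₑₓ_ (map (b ∷_) (subsets n))
  sorted-∷ = AllPairsₚ.map⁺ (AllPairs.map (next refl) (subsets-sorted n))

module _ {_≺_ : Rel A ℓ} where

  AllPairs⇒≺-earlier : ∀ xs {F ys G} → AllPairs _≺_ (xs ++ F ∷ ys) → G ∈ₗ xs → G ≺ F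
  AllPairs⇒≺-earlier (_ ∷ xs) (G≺ ∷ _) (Any.here refl)   = All.lookup G≺ (∈-++⁺ʳ xs (Any.here refl))
  AllPairs⇒≺-earlier (_ ∷ xs) (_ ∷ sorted) (Any.there G∈xs) = AllPairs⇒≺-earlier xs sorted G∈xs

  AllPairs∧≺⇒∈-earlier : Asymmetric _≺_ → ∀ xs {F ys H} → AllPairs _≺_ (xs ++ F ∷ ys) →
                          H ∈ₗ xs ++ F ∷ ys → H ≺ F → H ∈ₗ xs
  AllPairs∧≺⇒∈-earlier asym [] _ (Any.here refl) H≺F = ⊥-elim (asym H≺F H≺F)
  AllPairs∧≺⇒∈-earlier asym [] (F≺ ∷ _) (Any.there H∈ys) H≺F = ⊥-elim (asym H≺F (All.lookup F≺ H∈ys))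
  AllPairs∧≺⇒∈-earlier asym (_ ∷ xs) _ (Any.here refl) _ = Any.here refl
  AllPairs∧≺⇒∈-earlier asym (_ ∷ xs) (_ ∷ sorted) (Any.there H∈) H≺F =
    Any.there (AllPairs∧≺⇒∈-earlier asym xs sorted H∈ H≺F)

  AllPairs⇒Unique : Asymmetric _≺_ → ∀ {xs} → AllPairs _≺_ xs → Unique xs
  AllPairs⇒Unique asym = AllPairs.map λ { x≺x refl → asym x≺x x≺x }

ShellingOrder-++⁻ˡ : ∀ {d} (L : List (Subset n)) {L′} → ShellingOrder d (L ++ L′) → ShellingOrder d L
ShellingOrder-++⁻ˡ _ {L′} shelling xs ys F refl = shelling xs (ys ++ L′) F (++-assoc xs (F ∷ ys) L′)

shellingOrder-byExchange :
  ∀ {d} {_≺_ : Rel (Subset n) ℓ} {L} → Asymmetric _≺_ → AllPairs _≺_ L →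
  (∀ {F} → F ∈ₗ L → ∣ F ∣ ≡ d) →
  (∀ {G F} → G ∈ₗ L → F ∈ₗ L → G ≺ F →
     ∃₂ λ x y → x ∈ F × x ∉ G × y ∉ F × replace F x y ∈ₗ L × replace F x y ≺ F) →
  ShellingOrder d L
shellingOrder-byExchange {d = d} asym sorted size exch xs ys F refl G G∈xs
  with exch (∈-++⁺ˡ G∈xs) (∈-++⁺ʳ xs (Any.here refl)) (AllPairs⇒≺-earlier xs sorted G∈xs)
... | x , y , x∈F , x∉G , y∉F , H∈L , H≺F =
  replace F x y , AllPairs∧≺⇒∈-earlier asym xs sorted H∈L H≺F , G∩F⊆H∩F , ∣H∩F∣≡d-1
  where
  G∩F⊆H∩F : G ∩ F ⊆ replace F x y ∩ F
  G∩F⊆H∩F z∈G∩F with x∈p∩q⁻ G F z∈G∩F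
  ... | z∈G , z∈F = x∈p∩q⁺ (∈-replace⁺ y z∈F (λ { refl → x∉G z∈G }) , z∈F)
  ∣H∩F∣≡d-1 : ∣ replace F x y ∩ F ∣ ≡ d ∸ 1
  ∣H∩F∣≡d-1 = trans (cong ∣_∣ (replace∩p≡p-x y∉F))
    (cong (_∸ 1) (trans (x∈p⇒1+∣p-x∣≡∣p∣ F x∈F) (size (∈-++⁺ʳ xs (Any.here refl)))))

module MatroidRank {n d : ℕ} (M : Matroid n d) where

  open Matroid M

  Independent : Subset n → Set
  Independent I = ∃ λ B → IsBasis B × I ⊆ B

  Independent-⊆ : ∀ {I J} → I ⊆ J → Independent J → Independent I
  Independent-⊆ I⊆J (B , b , J⊆B) = B , b , J⊆B ∘ I⊆J

  -- Exchanging the elements of A outside both C and S for elements of C keeps A ∩ S,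
  -- and once A ─ C ⊆ S the counting lemma applies.
  exchange-outside : ∀ S {C} → IsBasis C → ∀ A → IsBasis A →
    ∃ λ B → IsBasis B × A ∩ S ⊆ B × ∣ C ∩ S ∣ ≤ ∣ B ∩ S ∣
  exchange-outside S {C} c A a = go A a (<-wellFounded ∣ A ─ C ∣)
    where
    go : ∀ A → IsBasis A → Acc _<_ ∣ A ─ C ∣ → ∃ λ B → IsBasis B × A ∩ S ⊆ B × ∣ C ∩ S ∣ ≤ ∣ B ∩ S ∣
    go A a (acc rec) with any? (λ x → x ∈? A ×-dec ¬? (x ∈? C) ×-dec ¬? (x ∈? S))
    ... | no ∄x = A , a , p∩q⊆p A S ,
      ∣p∣≡∣q∣∧p─q⊆r⇒∣q∩r∣≤∣p∩r∣ A C S (trans (basisSize A a) (sym (basisSize C c))) A─C⊆S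
      where
      A─C⊆S : A ─ C ⊆ S
      A─C⊆S {x} x∈ with x ∈? S
      ... | yes x∈S = x∈S
      ... | no  x∉S = ⊥-elim (∄x (x , p─q⊆p A C x∈ , x∈p─q⇒x∉q A C x∈ , x∉S))
    ... | yes (x , x∈A , x∉C , x∉S) with exchange A C x a c x∈A x∉C
    ... | y , y∈C , y∉A , a′ with go (replace A x y) a′ (rec (∣replace─q∣<∣p─q∣ x∈A x∉C y∈C))
    ... | B , b , A′∩S⊆B , ∣C∩S∣≤∣B∩S∣ = B , b , A∩S⊆B , ∣C∩S∣≤∣B∩S∣
      where
      A∩S⊆B : A ∩ S ⊆ B
      A∩S⊆B z∈ with x∈p∩q⁻ A S z∈
      ... | z∈A , z∈S = A′∩S⊆B (x∈p∩q⁺ (∈-replace⁺ y z∈A (λ { refl → x∉S z∈S }) , z∈S))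

  -- Abstract because unfolding argmax during unification is prohibitively slow.
  abstract
    bases : List (Subset n)
    bases = filter isBasis? (subsets n)

    maxBasis : Subset n → Subset n
    maxBasis N = argmax (λ B → ∣ B ∩ N ∣) (proj₁ nonempty) bases

    rank : Subset n → ℕ
    rank N = ∣ maxBasis N ∩ N ∣

    rank-attained : ∀ N → ∃ λ B → IsBasis B × ∣ B ∩ N ∣ ≡ rank N
    rank-attained N = maxBasis N , argmax-all (λ B → ∣ B ∩ N ∣) (proj₂ nonempty)
      (All.tabulate λ B∈ → proj₂ (∈-filter⁻ isBasis? {xs = subsets n} B∈)) , refl

    ∣B∩N∣≤rank : ∀ {B} N → IsBasis B → ∣ B ∩ N ∣ ≤ rank N
    ∣B∩N∣≤rank N b = All.lookup (f[xs]≤f[argmax] {f = λ B → ∣ B ∩ N ∣} (proj₁ nonempty) bases)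
      (∈-filter⁺ isBasis? (∈-subsets _) b)

  rank-witness : ∀ N → ∃ λ I → Independent I × I ⊆ N × ∣ I ∣ ≡ rank N
  rank-witness N with rank-attained N
  ... | B , b , ∣B∩N∣≡rank = B ∩ N , (B , b , p∩q⊆p B N) , p∩q⊆q B N , ∣B∩N∣≡rank

  ∣I∣≤rank : ∀ {I N} → Independent I → I ⊆ N → ∣ I ∣ ≤ rank N
  ∣I∣≤rank {I} {N} (B , b , I⊆B) I⊆N =
    ≤-trans (p⊆q⇒∣p∣≤∣q∣ λ z∈I → x∈p∩q⁺ (I⊆B z∈I , I⊆N z∈I)) (∣B∩N∣≤rank N b)

  rank≤d : ∀ N → rank N ≤ d
  rank≤d N with rank-attained N
  ... | B , b , ∣B∩N∣≡rank = subst (_≤ d) ∣B∩N∣≡rank (≤-trans (∣p∩q∣≤∣p∣ B N) (≤-reflexive (basisSize B b)))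

  rank-mono : ∀ {N N′} → N ⊆ N′ → rank N ≤ rank N′
  rank-mono {N} N⊆N′ with rank-witness N
  ... | I , i , I⊆N , ∣I∣≡rank = subst (_≤ _) ∣I∣≡rank (∣I∣≤rank i (N⊆N′ ∘ I⊆N))

  rank≤1+rank[p-x] : ∀ F x → rank F ≤ suc (rank (F - x))
  rank≤1+rank[p-x] F x with rank-witness F
  ... | K , k , K⊆F , ∣K∣≡rank = begin
    rank F             ≡⟨ sym ∣K∣≡rank ⟩
    ∣ K ∣              ≤⟨ ∣p∣≤1+∣p-x∣ K x ⟩
    suc ∣ K - x ∣      ≤⟨ s≤s (∣I∣≤rank (Independent-⊆ (p─q⊆p K ⁅ x ⁆) k) K-x⊆F-x) ⟩
    suc (rank (F - x)) ∎
    where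
    open ≤-Reasoning
    K-x⊆F-x : K - x ⊆ F - x
    K-x⊆F-x z∈ = x∈p∧x≢y⇒x∈p-y (K⊆F (p─q⊆p K ⁅ x ⁆ z∈)) (x∈p-y⇒x≢y K z∈)

  independent-extend : ∀ {I N} → Independent I → I ⊆ N →
    ∃ λ J → Independent J × I ⊆ J × J ⊆ N × ∣ J ∣ ≡ rank N
  independent-extend {I} {N} (A , a , I⊆A) I⊆N with rank-attained N
  ... | C , c , ∣C∩N∣≡rank with exchange-outside N c A a
  ... | B , b , A∩N⊆B , ∣C∩N∣≤∣B∩N∣ = B ∩ N , (B , b , p∩q⊆p B N) , I⊆B∩N , p∩q⊆q B N ,
    ≤-antisym (∣B∩N∣≤rank N b) (subst (_≤ _) ∣C∩N∣≡rank ∣C∩N∣≤∣B∩N∣)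
    where
    I⊆B∩N : I ⊆ B ∩ N
    I⊆B∩N z∈I = x∈p∩q⁺ (A∩N⊆B (x∈p∩q⁺ (I⊆A z∈I , I⊆N z∈I)) , I⊆N z∈I)

  independent-augment : ∀ {I J} → Independent I → Independent J → ∣ I ∣ < ∣ J ∣ →
    ∃ λ z → z ∈ J × z ∉ I × Independent (I ∪ ⁅ z ⁆)
  independent-augment {I} {J} i j ∣I∣<∣J∣ with independent-extend i (p⊆p∪q {p = I} J)
  ... | K , k , I⊆K , K⊆I∪J , ∣K∣≡rank with ∣q∣<∣p∣⇒∃x∈p∧x∉q K I ∣I∣<∣K∣
    where
    ∣I∣<∣K∣ : ∣ I ∣ < ∣ K ∣
    ∣I∣<∣K∣ = <-≤-trans ∣I∣<∣J∣ (subst (_ ≤_) (sym ∣K∣≡rank) (∣I∣≤rank j (q⊆p∪q I J)))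
  ... | z , z∈K , z∉I = z , z∈J , z∉I , Independent-⊆ (p⊆r∧x∈r⇒p∪⁅x⁆⊆r I⊆K z∈K) k
    where
    z∈J : z ∈ J
    z∈J with x∈p∪q⁻ I J (K⊆I∪J z∈K)
    ... | inj₁ z∈I = ⊥-elim (z∉I z∈I)
    ... | inj₂ z∈J = z∈J

  1+∣I∣≤rank : ∀ {I z N} → Independent (I ∪ ⁅ z ⁆) → I ∪ ⁅ z ⁆ ⊆ N → z ∉ I → suc ∣ I ∣ ≤ rank N
  1+∣I∣≤rank {I} i+z I+z⊆N z∉I = subst (_≤ _) (x∉p⇒∣p∪⁅x⁆∣≡1+∣p∣ I z∉I) (∣I∣≤rank i+z I+z⊆N)

  rank≤rank[p∩q]+∣q─p∣ : ∀ F G → rank G ≤ rank (F ∩ G) + ∣ G ─ F ∣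
  rank≤rank[p∩q]+∣q─p∣ F G with rank-witness G
  ... | J , j , J⊆G , ∣J∣≡rank = begin
    rank G                    ≡⟨ sym ∣J∣≡rank ⟩
    ∣ J ∣                     ≡⟨ ∣p∣≡∣p∩q∣+∣p─q∣ J F ⟩
    ∣ J ∩ F ∣ + ∣ J ─ F ∣     ≤⟨ +-mono-≤ (∣I∣≤rank (Independent-⊆ (p∩q⊆p J F) j) J∩F⊆F∩G)
                                          (p⊆q⇒∣p∣≤∣q∣ J─F⊆G─F) ⟩
    rank (F ∩ G) + ∣ G ─ F ∣  ∎
    where
    open ≤-Reasoning
    J∩F⊆F∩G : J ∩ F ⊆ F ∩ G
    J∩F⊆F∩G z∈ = x∈p∩q⁺ (p∩q⊆q J F z∈ , J⊆G (p∩q⊆p J F z∈))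
    J─F⊆G─F : J ─ F ⊆ G ─ F
    J─F⊆G─F z∈ = x∈p∧x∉q⇒x∈p─q (J⊆G (p─q⊆p J F z∈)) (x∈p─q⇒x∉q J F z∈)

  -- Extend a maximal independent subset of F ∩ G to one, I, of F.  If I contained F ─ G,
  -- counting would give rank G ≤ rank F; so some x ∈ F ─ G is outside I, and augmenting I
  -- from G adds an element outside F.
  rank-raising-exchange : ∀ {F G} → ∣ G ∣ ≡ ∣ F ∣ → rank F < rank G →
    ∃₂ λ x y → x ∈ F × x ∉ G × y ∉ F × rank F < rank (replace F x y)
  rank-raising-exchange {F} {G} ∣G∣≡∣F∣ rkF<rkG with rank-witness (F ∩ G)
  ... | I₀ , i₀ , I₀⊆F∩G , ∣I₀∣≡rank with independent-extend i₀ (p∩q⊆p F G ∘ I₀⊆F∩G)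
  ... | I , i , I₀⊆I , I⊆F , ∣I∣≡rank with any? (λ x → x ∈? F ×-dec ¬? (x ∈? G) ×-dec ¬? (x ∈? I))
  ... | no ∄x = ⊥-elim (<⇒≱ rkF<rkG (begin
    rank G                    ≤⟨ rank≤rank[p∩q]+∣q─p∣ F G ⟩
    rank (F ∩ G) + ∣ G ─ F ∣  ≡⟨ cong₂ _+_ (sym ∣I₀∣≡rank) (∣p∣≡∣q∣⇒∣p─q∣≡∣q─p∣ G F ∣G∣≡∣F∣) ⟩
    ∣ I₀ ∣ + ∣ F ─ G ∣        ≤⟨ +-mono-≤ (p⊆q⇒∣p∣≤∣q∣ I₀⊆I∩G) (p⊆q⇒∣p∣≤∣q∣ F─G⊆I─G) ⟩
    ∣ I ∩ G ∣ + ∣ I ─ G ∣     ≡⟨ sym (∣p∣≡∣p∩q∣+∣p─q∣ I G) ⟩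
    ∣ I ∣                     ≡⟨ ∣I∣≡rank ⟩
    rank F                    ∎))
    where
    open ≤-Reasoning
    I₀⊆I∩G : I₀ ⊆ I ∩ G
    I₀⊆I∩G z∈ = x∈p∩q⁺ (I₀⊆I z∈ , p∩q⊆q F G (I₀⊆F∩G z∈))
    F─G⊆I─G : F ─ G ⊆ I ─ G
    F─G⊆I─G {z} z∈ with z ∈? I
    ... | yes z∈I = x∈p∧x∉q⇒x∈p─q z∈I (x∈p─q⇒x∉q F G z∈)
    ... | no  z∉I = ⊥-elim (∄x (z , p─q⊆p F G z∈ , x∈p─q⇒x∉q F G z∈ , z∉I))
  ... | yes (x , x∈F , x∉G , x∉I) with rank-witness G
  ... | J , j , J⊆G , ∣J∣≡rank with independent-augment i j (subst₂ _<_ (sym ∣I∣≡rank) (sym ∣J∣≡rank) rkF<rkG)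
  ... | z , _ , z∉I , i+z = x , z , x∈F , x∉G , z∉F , subst (_< _) ∣I∣≡rank (1+∣I∣≤rank i+z I+z⊆F′ z∉I)
    where
    z∉F : z ∉ F
    z∉F z∈F = <⇒≱ (1+∣I∣≤rank i+z (p⊆r∧x∈r⇒p∪⁅x⁆⊆r I⊆F z∈F) z∉I) (≤-reflexive (sym ∣I∣≡rank))
    I+z⊆F′ : I ∪ ⁅ z ⁆ ⊆ replace F x z
    I+z⊆F′ = p⊆r∧x∈r⇒p∪⁅x⁆⊆r (λ w∈I → ∈-replace⁺ z (I⊆F w∈I) λ { refl → x∉I w∈I }) (y∈replace F x z)

  -- If F - x has full rank any y ∈ G ─ F will do; otherwise augment a maximal independent
  -- subset of F - x from G.
  rank-keeping-exchange : ∀ {F G x} → ∣ G ∣ ≡ ∣ F ∣ → rank F ≤ rank G → x ∈ F → x ∉ G →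
    ∃ λ y → y ∈ G × y ∉ F × rank F ≤ rank (replace F x y)
  rank-keeping-exchange {F} {G} {x} ∣G∣≡∣F∣ rkF≤rkG x∈F x∉G with rank F ≤? rank (F - x)
  ... | yes rkF≤ with ∣q∣<∣p∣⇒∃x∈p∧x∉q G (F - x) (subst (∣ F - x ∣ <_) (sym ∣G∣≡∣F∣) (x∈p⇒∣p-x∣<∣p∣ x∈F))
  ... | y , y∈G , y∉F-x =
    y , y∈G , x∉p-y∧x≢y⇒x∉p y∉F-x (λ { refl → x∉G y∈G }) , ≤-trans rkF≤ (rank-mono (p-x⊆replace F y))
  rank-keeping-exchange {F} {G} {x} ∣G∣≡∣F∣ rkF≤rkG x∈F x∉G | no rkF≰ with rank-witness (F - x) | rank-witness G
  ... | I , i , I⊆F-x , ∣I∣≡rank | J , j , J⊆G , ∣J∣≡rank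
    with independent-augment i j (subst₂ _<_ (sym ∣I∣≡rank) (sym ∣J∣≡rank) (<-≤-trans (≰⇒> rkF≰) rkF≤rkG))
  ... | z , z∈J , z∉I , i+z = z , J⊆G z∈J , z∉F , (begin
    rank F                    ≤⟨ rank≤1+rank[p-x] F x ⟩
    suc (rank (F - x))        ≡⟨ cong suc (sym ∣I∣≡rank) ⟩
    suc ∣ I ∣                 ≤⟨ 1+∣I∣≤rank i+z I+z⊆F′ z∉I ⟩
    rank (replace F x z)      ∎)
    where
    open ≤-Reasoning
    z∉F : z ∉ F
    z∉F = x∉p-y∧x≢y⇒x∉p
      (λ z∈F-x → <⇒≱ (1+∣I∣≤rank i+z (p⊆r∧x∈r⇒p∪⁅x⁆⊆r I⊆F-x z∈F-x) z∉I) (≤-reflexive (sym ∣I∣≡rank)))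
      (λ { refl → x∉G (J⊆G z∈J) })
    I+z⊆F′ : I ∪ ⁅ z ⁆ ⊆ replace F x z
    I+z⊆F′ = p⊆r∧x∈r⇒p∪⁅x⁆⊆r (p-x⊆replace F z ∘ I⊆F-x) (y∈replace F x z)

module RankOrder {n d : ℕ} (M : Matroid n d) where

  open Matroid M
  open MatroidRank M

  _≺_ : Rel (Subset n) _
  _≺_ = ×-Lex _≡_ _>_ _<ₗₑₓ_ on λ N → rank N , N

  ≺-asym : Asymmetric _≺_
  ≺-asym {G} {F} = ×-asymmetric sym (resp₂ _>_) <-asym <ₗₑₓ-asym {rank G , G} {rank F , F}

  ≺-exchange : ∀ {G F} → ∣ G ∣ ≡ ∣ F ∣ → G ≺ F →
    ∃₂ λ x y → x ∈ F × x ∉ G × y ∉ F × replace F x y ≺ F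
  ≺-exchange ∣G∣≡∣F∣ (inj₁ rkF<rkG) with rank-raising-exchange ∣G∣≡∣F∣ rkF<rkG
  ... | x , y , x∈F , x∉G , y∉F , rkF<rk = x , y , x∈F , x∉G , y∉F , inj₁ rkF<rk
  ≺-exchange ∣G∣≡∣F∣ (inj₂ (rkG≡rkF , G<F)) with <ₗₑₓ-replace G<F
  ... | x , x∈F , x∉G , lower
    with rank-keeping-exchange ∣G∣≡∣F∣ (≤-reflexive (sym rkG≡rkF)) x∈F x∉G
  ... | y , y∈G , y∉F , rkF≤rk with m≤n⇒m<n∨m≡n rkF≤rk
  ... | inj₁ rkF<rk = x , y , x∈F , x∉G , y∉F , inj₁ rkF<rk
  ... | inj₂ rkF≡rk = x , y , x∈F , x∉G , y∉F , inj₂ (sym rkF≡rk , lower y∈G y∉F)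

  dSubsetOfRank? : ∀ k N → Dec (∣ N ∣ ≡ d × rank N ≡ k)
  dSubsetOfRank? k N = ∣ N ∣ ≟ d ×-dec rank N ≟ k

  dSubsetsOfRank : ℕ → List (Subset n)
  dSubsetsOfRank k = filter (dSubsetOfRank? k) (subsets n)

  dSubsetsOfRank< : ℕ → List (Subset n)
  dSubsetsOfRank< zero    = []
  dSubsetsOfRank< (suc k) = dSubsetsOfRank k ++ dSubsetsOfRank< k

  ∈-dSubsetsOfRank⁻ : ∀ {k N} → N ∈ₗ dSubsetsOfRank k → ∣ N ∣ ≡ d × rank N ≡ k
  ∈-dSubsetsOfRank⁻ N∈ = proj₂ (∈-filter⁻ (dSubsetOfRank? _) {xs = subsets n} N∈)

  ∈-dSubsetsOfRank⁺ : ∀ {k N} → ∣ N ∣ ≡ d → rank N ≡ k → N ∈ₗ dSubsetsOfRank k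
  ∈-dSubsetsOfRank⁺ ∣N∣≡d rkN≡k = ∈-filter⁺ (dSubsetOfRank? _) (∈-subsets _) (∣N∣≡d , rkN≡k)

  ∈-dSubsetsOfRank<⁻ : ∀ k {N} → N ∈ₗ dSubsetsOfRank< k → ∣ N ∣ ≡ d × rank N < k
  ∈-dSubsetsOfRank<⁻ (suc k) N∈ with ∈-++⁻ (dSubsetsOfRank k) N∈
  ... | inj₁ N∈ₖ with ∈-dSubsetsOfRank⁻ N∈ₖ
  ...   | ∣N∣≡d , rkN≡k = ∣N∣≡d , s≤s (≤-reflexive rkN≡k)
  ∈-dSubsetsOfRank<⁻ (suc k) N∈ | inj₂ N∈< with ∈-dSubsetsOfRank<⁻ k N∈<
  ...   | ∣N∣≡d , rkN<k = ∣N∣≡d , m<n⇒m<1+n rkN<k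

  ∈-dSubsetsOfRank<⁺ : ∀ k {N} → ∣ N ∣ ≡ d → rank N < k → N ∈ₗ dSubsetsOfRank< k
  ∈-dSubsetsOfRank<⁺ (suc k) ∣N∣≡d (s≤s rkN≤k) with m≤n⇒m<n∨m≡n rkN≤k
  ... | inj₁ rkN<k = ∈-++⁺ʳ (dSubsetsOfRank k) (∈-dSubsetsOfRank<⁺ k ∣N∣≡d rkN<k)
  ... | inj₂ rkN≡k = ∈-++⁺ˡ (∈-dSubsetsOfRank⁺ ∣N∣≡d rkN≡k)

  dSubsetsOfRank-sorted : ∀ k → AllPairs _≺_ (dSubsetsOfRank k)
  dSubsetsOfRank-sorted k = sameRank (All.tabulate (proj₂ ∘ ∈-dSubsetsOfRank⁻))
    (AllPairsₚ.filter⁺ (dSubsetOfRank? k) (subsets-sorted n))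
    where
    sameRank : ∀ {Ns} → All.All (λ N → rank N ≡ k) Ns → AllPairs _<ₗₑₓ_ Ns → AllPairs _≺_ Ns
    sameRank All.[]               []             = []
    sameRank (rkG≡k All.∷ rk≡k) (G< ∷ sorted) =
      All.zipWith (λ (rkF≡k , G<F) → inj₂ (trans rkG≡k (sym rkF≡k) , G<F)) (rk≡k , G<) ∷ sameRank rk≡k sorted

  dSubsetsOfRank<-sorted : ∀ k → AllPairs _≺_ (dSubsetsOfRank< k)
  dSubsetsOfRank<-sorted zero    = []
  dSubsetsOfRank<-sorted (suc k) = AllPairsₚ.++⁺ (dSubsetsOfRank-sorted k) (dSubsetsOfRank<-sorted k)
    (All.tabulate λ G∈ → All.tabulate λ H∈ →
      inj₁ (subst (_ <_) (sym (proj₂ (∈-dSubsetsOfRank⁻ G∈))) (proj₂ (∈-dSubsetsOfRank<⁻ k H∈))))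

  ∈-dSubsetsOfRank-d⇔isBasis : ∀ {N} → N ∈ₗ dSubsetsOfRank d ⇔ IsBasis N
  ∈-dSubsetsOfRank-d⇔isBasis {N} = mk⇔ (fullRank⇒isBasis ∘ ∈-dSubsetsOfRank⁻)
    (λ b → ∈-dSubsetsOfRank⁺ (basisSize N b) (rank≡d b))
    where
    rank≡d : IsBasis N → rank N ≡ d
    rank≡d b = ≤-antisym (rank≤d N)
      (subst (_≤ rank N) (trans (cong ∣_∣ (∩-idem N)) (basisSize N b)) (∣B∩N∣≤rank N b))
    fullRank⇒isBasis : ∣ N ∣ ≡ d × rank N ≡ d → IsBasis N
    fullRank⇒isBasis (∣N∣≡d , rkN≡d) with rank-witness N
    ... | I , (B , b , I⊆B) , I⊆N , ∣I∣≡rank = subst IsBasis B≡N b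
      where
      ∣I∣≡d : ∣ I ∣ ≡ d
      ∣I∣≡d = trans ∣I∣≡rank rkN≡d
      B≡N : B ≡ N
      B≡N = trans (sym (p⊆q∧∣q∣≤∣p∣⇒p≡q I⊆B (≤-reflexive (trans (basisSize B b) (sym ∣I∣≡d)))))
                  (p⊆q∧∣q∣≤∣p∣⇒p≡q I⊆N (≤-reflexive (trans ∣N∣≡d (sym ∣I∣≡d))))

  dSubsets : List (Subset n)
  dSubsets = dSubsetsOfRank< (suc d)

  ∈-dSubsets⇔ : ∀ {N} → N ∈ₗ dSubsets ⇔ DSubset d N
  ∈-dSubsets⇔ {N} = mk⇔ (proj₁ ∘ ∈-dSubsetsOfRank<⁻ (suc d))
    (λ ∣N∣≡d → ∈-dSubsetsOfRank<⁺ (suc d) ∣N∣≡d (s≤s (rank≤d N)))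

  dSubsets-shellingOrder : ShellingOrder d dSubsets
  dSubsets-shellingOrder = shellingOrder-byExchange ≺-asym (dSubsetsOfRank<-sorted (suc d))
    (Equivalence.to ∈-dSubsets⇔) exchange∈
    where
    exchange∈ : ∀ {G F} → G ∈ₗ dSubsets → F ∈ₗ dSubsets → G ≺ F →
      ∃₂ λ x y → x ∈ F × x ∉ G × y ∉ F × replace F x y ∈ₗ dSubsets × replace F x y ≺ F
    exchange∈ G∈ F∈ G≺F with Equivalence.to ∈-dSubsets⇔ G∈ | Equivalence.to ∈-dSubsets⇔ F∈
    ... | ∣G∣≡d | ∣F∣≡d with ≺-exchange (trans ∣G∣≡d (sym ∣F∣≡d)) G≺F
    ... | x , y , x∈F , x∉G , y∉F , H≺F = x , y , x∈F , x∉G , y∉F ,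
      Equivalence.from ∈-dSubsets⇔ (trans (∣replace∣≡∣p∣ x∈F y∉F) ∣F∣≡d) , H≺F

  dSubsets-isShelling : IsShellingOf d (DSubset d) dSubsets
  dSubsets-isShelling =
    AllPairs⇒Unique ≺-asym (dSubsetsOfRank<-sorted (suc d)) , (λ _ → ∈-dSubsets⇔) , dSubsets-shellingOrder

  bases-isShelling : IsShellingOf d IsBasis (dSubsetsOfRank d)
  bases-isShelling =
    AllPairs⇒Unique ≺-asym (dSubsetsOfRank-sorted d) , (λ _ → ∈-dSubsetsOfRank-d⇔isBasis) ,
    ShellingOrder-++⁻ˡ {d = d} (dSubsetsOfRank d) dSubsets-shellingOrder

corollary3p1 : ∀ (n d : ℕ) (M : Matroid n d) →
    ShellingCompletable d (Matroid.IsBasis M)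
corollary3p1 n d M = dSubsetsOfRank d , dSubsetsOfRank< d , bases-isShelling , dSubsets-isShelling
  where open RankOrder M
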